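{- Let $k\ge 1$, $n\ge 5$ and $T_{5k,n}=C_{5k}\Box C_n$. Then $\chi(T_{5k,n}^2)\le 5$ if $n\equiv 0\pmod 5$; $\chi(T_{5k,n}^2)\le 7$ if $n=7$; and $\chi(T_{5k,n}^2)\le 6$ otherwise.
   Context: $C_j$ denotes the cycle on $j$ vertices; $\Box$ is the Cartesian product of graphs. The square $G^2$ of a graph $G$ has vertex set $V(G)$, two distinct vertices being adjacent iff their distance in $G$ is at most 2. $\chi$ is the chromatic number. -}

module Defs where

open import Data.Nat using (ℕ; suc)
open import Data.Fin using (Fin; toℕ)
open import Data.Product using (_×_; _,_; ∃)
open import Data.Sum using (_⊎_)
open import Relation.Binary.PropositionalEquality using (_≡_)
open import Relation.Nullary using (¬_)

record Graph : Set₁ where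
  field
    V   : Set
    Adj : V → V → Set
open Graph public

-- Successor modulo m on Fin m: i ↦ i+1 mod m (the last vertex wraps to 0).
-- The cycle C_m (m ≥ 3): i ~ j iff j ≡ i+1 (mod m) or i ≡ j+1 (mod m).
CycleStep : (m : ℕ) → Fin m → Fin m → Set
CycleStep m i j = (suc (toℕ i) ≡ toℕ j) ⊎ (suc (toℕ i) ≡ m × toℕ j ≡ 0)

Cycle : ℕ → Graph
Cycle m = record
  { V   = Fin m
  ; Adj = λ i j → CycleStep m i j ⊎ CycleStep m j i }

_□_ : Graph → Graph → Graph
G □ H = record
  { V   = V G × V H
  ; Adj = λ { (g , h) (g′ , h′) →
            (Adj G g g′ × h ≡ h′) ⊎ (g ≡ g′ × Adj H h h′) } }

square : Graph → Graph
square G = record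
  { V   = V G
  ; Adj = λ u v → ¬ (u ≡ v) × (Adj G u v ⊎ ∃ λ w → Adj G u w × Adj G w v) }

ProperColouring : Graph → ℕ → Set
ProperColouring G c = ∃ λ (f : V G → Fin c) → ∀ u v → Adj G u v → ¬ (f u ≡ f v)

χ≤ : Graph → ℕ → Set
χ≤ G c = ProperColouring G c

T : ℕ → ℕ → Graph
T m n = Cycle m □ Cycle n

-- All colourings are "pattern colourings": vertex (i , j) gets the colour
-- N_j (i mod 5), where N_0, N_1, … is a cyclic sequence of columns, each column
-- being a colouring of the residues mod 5.  Such a colouring is proper on the
-- square as soon as every three cyclically consecutive columns s, t, u are
-- locally proper: s separates residues at distance 1 and 2, s and t differ at
-- equal and at diagonally adjacent residues, and s and u differ at equal residues.
--
-- Explicit admissible words with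
-- 5, 6 and 7 colours (checked by computation), pumped by a block of length 5,
-- cover every n ≥ 5, and corollary4 follows by a case split on n mod 5.
module Submission where

open import Defs
open import Data.Nat using (ℕ; _*_; _≤_; _%_)
open import Relation.Binary.PropositionalEquality using (_≡_)
open import Relation.Nullary using (¬_)
open import Data.Product using (_×_)

open import Data.Nat using (zero; suc; _+_; _<_; s≤s)
open import Data.Nat.Properties using (<⇒≢; suc-injective; *-comm; +-comm; +-assoc; m≤n⇒∃[o]m+o≡n)
open import Data.Nat.DivMod using ([m+kn]%n≡m%n)
open import Data.Fin using (Fin; toℕ; #_) renaming (zero to fzero; suc to fsuc)
open import Data.Fin.Properties using (toℕ-injective; toℕ<n; all?) renaming (_≟_ to _≟ᶠ_)
open import Data.List using (List; []; _∷_; _++_; length)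
open import Data.List.Properties using (length-++; ++-assoc)
open import Data.Vec using (lookup) renaming (_∷_ to _∷ᵛ_; [] to []ᵛ)
open import Data.Unit using (⊤; tt)
open import Data.Empty using (⊥-elim)
open import Data.Sum using (_⊎_; inj₁; inj₂; [_,_])
open import Data.Product using (_,_; ∃)
open import Function using (_∘_)
open import Relation.Nullary using (Dec; yes; ¬?)
open import Relation.Nullary.Decidable using (map′; _×-dec_; from-yes)
open import Relation.Binary.PropositionalEquality using (refl; sym; trans; cong; cong₂; cong-app; subst; module ≡-Reasoning)

open ≡-Reasoning

step-functional : ∀ {m} {a b c : Fin m} → CycleStep m a b → CycleStep m a c → b ≡ c
step-functional (inj₁ p) (inj₁ q) = toℕ-injective (trans (sym p) q)
step-functional {b = b} (inj₁ p) (inj₂ (q , _)) = ⊥-elim (<⇒≢ (toℕ<n b) (trans (sym p) q))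
step-functional {c = c} (inj₂ (p , _)) (inj₁ q) = ⊥-elim (<⇒≢ (toℕ<n c) (trans (sym q) p))
step-functional (inj₂ (_ , p)) (inj₂ (_ , q)) = toℕ-injective (trans p (sym q))

step-injective : ∀ {m} {a b c : Fin m} → CycleStep m a c → CycleStep m b c → a ≡ b
step-injective (inj₁ p) (inj₁ q) = toℕ-injective (suc-injective (trans p (sym q)))
step-injective (inj₁ p) (inj₂ (_ , q)) with () ← trans p q
step-injective (inj₂ (_ , p)) (inj₁ q) with () ← trans q p
step-injective (inj₂ (p , _)) (inj₂ (q , _)) = toℕ-injective (suc-injective (trans p (sym q)))

TwoSteps : (m : ℕ) → Fin m → Fin m → Set
TwoSteps m i j = ∃ λ w → CycleStep m i w × CycleStep m w j

walk-of-length-two : ∀ {m} {i w j : Fin m} → Adj (Cycle m) i w → Adj (Cycle m) w j →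
  i ≡ j ⊎ TwoSteps m i j ⊎ TwoSteps m j i
walk-of-length-two (inj₁ a) (inj₁ b) = inj₂ (inj₁ (_ , a , b))
walk-of-length-two (inj₁ a) (inj₂ b) = inj₁ (step-injective a b)
walk-of-length-two (inj₂ a) (inj₁ b) = inj₁ (step-functional a b)
walk-of-length-two (inj₂ a) (inj₂ b) = inj₂ (inj₂ (_ , b , a))

step-label : ∀ {m} {X : Set} (φ : ℕ → X) → φ m ≡ φ 0 →
  ∀ {i j : Fin m} → CycleStep m i j → φ (toℕ j) ≡ φ (suc (toℕ i))
step-label φ wrap (inj₁ p) = cong φ (sym p)
step-label {m} φ wrap {i} {j} (inj₂ (p , q)) = begin
  φ (toℕ j)        ≡⟨ cong φ q ⟩
  φ 0              ≡⟨ sym wrap ⟩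
  φ m              ≡⟨ cong φ (sym p) ⟩
  φ (suc (toℕ i))  ∎

two-steps-label : ∀ {m} {X : Set} (φ : ℕ → X) → φ m ≡ φ 0 → φ (suc m) ≡ φ 1 →
  ∀ {i j : Fin m} → TwoSteps m i j → φ (toℕ j) ≡ φ (suc (suc (toℕ i)))
two-steps-label φ wrap₀ wrap₁ (_ , a , b) =
  trans (step-label φ wrap₀ b) (step-label (φ ∘ suc) wrap₁ a)

-- The ways in which u can reach v within distance two in C_m □ C_n, up to
-- exchanging u and v: one or two steps along the first cycle ("vertical"), one or
-- two steps along the second ("horizontal"), or one step along each ("diagonal").
data Near {m n : ℕ} : Fin m × Fin n → Fin m × Fin n → Set where
  vert₁  : ∀ {i i' j} → CycleStep m i i' → Near (i , j) (i' , j)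
  vert₂  : ∀ {i i' j} → TwoSteps m i i' → Near (i , j) (i' , j)
  horiz₁ : ∀ {i j j'} → CycleStep n j j' → Near (i , j) (i , j')
  horiz₂ : ∀ {i j j'} → TwoSteps n j j' → Near (i , j) (i , j')
  diag↗  : ∀ {i i' j j'} → CycleStep m i i' → CycleStep n j j' → Near (i , j) (i' , j')
  diag↘  : ∀ {i i' j j'} → CycleStep m i i' → CycleStep n j' j → Near (i , j) (i' , j')

vertical-edge : ∀ {m n} {i i' : Fin m} {j : Fin n} → Adj (Cycle m) i i' →
  Near (i , j) (i' , j) ⊎ Near (i' , j) (i , j)
vertical-edge (inj₁ s) = inj₁ (vert₁ s)
vertical-edge (inj₂ s) = inj₂ (vert₁ s)

horizontal-edge : ∀ {m n} {i : Fin m} {j j' : Fin n} → Adj (Cycle n) j j' →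
  Near (i , j) (i , j') ⊎ Near (i , j') (i , j)
horizontal-edge (inj₁ s) = inj₁ (horiz₁ s)
horizontal-edge (inj₂ s) = inj₂ (horiz₁ s)

diagonal-edges : ∀ {m n} {i i' : Fin m} {j j' : Fin n} → Adj (Cycle m) i i' → Adj (Cycle n) j j' →
  Near (i , j) (i' , j') ⊎ Near (i' , j') (i , j)
diagonal-edges (inj₁ a) (inj₁ b) = inj₁ (diag↗ a b)
diagonal-edges (inj₁ a) (inj₂ b) = inj₁ (diag↘ a b)
diagonal-edges (inj₂ a) (inj₁ b) = inj₂ (diag↘ a b)
diagonal-edges (inj₂ a) (inj₂ b) = inj₂ (diag↗ a b)

square-torus-neighbours : ∀ {m n} {u v : Fin m × Fin n} →
  Adj (square (T m n)) u v → Near u v ⊎ Near v u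
square-torus-neighbours (_ , inj₁ (inj₁ (a , refl))) = vertical-edge a
square-torus-neighbours (_ , inj₁ (inj₂ (refl , b))) = horizontal-edge b
square-torus-neighbours (_ , inj₂ (_ , inj₁ (a , refl) , inj₂ (refl , b))) = diagonal-edges a b
square-torus-neighbours (_ , inj₂ (_ , inj₂ (refl , a) , inj₁ (b , refl))) = diagonal-edges b a
square-torus-neighbours (u≢v , inj₂ (_ , inj₁ (a , refl) , inj₁ (b , refl)))
  with walk-of-length-two a b
... | inj₁ refl = ⊥-elim (u≢v refl)
... | inj₂ (inj₁ s) = inj₁ (vert₂ s)
... | inj₂ (inj₂ s) = inj₂ (vert₂ s)
square-torus-neighbours (u≢v , inj₂ (_ , inj₂ (refl , a) , inj₂ (refl , b)))
  with walk-of-length-two a b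
... | inj₁ refl = ⊥-elim (u≢v refl)
... | inj₂ (inj₁ s) = inj₁ (horiz₂ s)
... | inj₂ (inj₂ s) = inj₂ (horiz₂ s)

-- Pattern colourings

Apart : ∀ {R : Set} {q} → (R → Fin q) → (R → Fin q) → Set
Apart f g = ∀ r → ¬ (f r ≡ g r)

record LocallyProper {R : Set} {q} (σ : R → R) (s t u : R → Fin q) : Set where
  field
    vertical₁   : Apart s (s ∘ σ)
    vertical₂   : Apart s (s ∘ σ ∘ σ)
    horizontal₁ : Apart s t
    diagonal↗   : Apart s (t ∘ σ)
    diagonal↘   : Apart (s ∘ σ) t
    horizontal₂ : Apart s u

locallyProper? : ∀ {p q} (σ : Fin p → Fin p) (s t u : Fin p → Fin q) → Dec (LocallyProper σ s t u)
locallyProper? σ s t u =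
  map′ (λ (a , b , c , d , e , f) → record
         { vertical₁ = a ; vertical₂ = b ; horizontal₁ = c
         ; diagonal↗ = d ; diagonal↘ = e ; horizontal₂ = f })
       (λ lp → let open LocallyProper lp in
         vertical₁ , vertical₂ , horizontal₁ , diagonal↗ , diagonal↘ , horizontal₂)
       (apart? s (s ∘ σ) ×-dec apart? s (s ∘ σ ∘ σ) ×-dec apart? s t ×-dec
        apart? s (t ∘ σ) ×-dec apart? (s ∘ σ) t ×-dec apart? s u)
  where
  apart? : ∀ {p q} (f g : Fin p → Fin q) → Dec (Apart f g)
  apart? f g = all? (λ r → ¬? (f r ≟ᶠ g r))

-- Rows of C_m are labelled by ρ, which advances by
-- σ and closes up after m steps; columns of C_n are labelled by N, which closes up
-- after n steps (for two consecutive positions, as columns two apart interact).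
module PatternColouring
  {R : Set} (σ : R → R) (ρ : ℕ → R) (ρ-suc : ∀ t → ρ (suc t) ≡ σ (ρ t))
  {q : ℕ} (N : ℕ → R → Fin q) {m n : ℕ}
  (ρ-wrap : ρ m ≡ ρ 0) (N-wrap₀ : N n ≡ N 0) (N-wrap₁ : N (suc n) ≡ N 1)
  (N-local : ∀ t → t < n → LocallyProper σ (N t) (N (suc t)) (N (suc (suc t))))
  where

  row : Fin m → R
  row i = ρ (toℕ i)

  column : Fin n → R → Fin q
  column j = N (toℕ j)

  colour : Fin m × Fin n → Fin q
  colour (i , j) = column j (row i)

  local : (j : Fin n) → LocallyProper σ (column j) (N (suc (toℕ j))) (N (suc (suc (toℕ j))))
  local j = N-local (toℕ j) (toℕ<n j)

  row-step : ∀ {i i'} → CycleStep m i i' → row i' ≡ σ (row i)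
  row-step {i} s = trans (step-label ρ ρ-wrap s) (ρ-suc (toℕ i))

  row-two-steps : ∀ {i i'} → TwoSteps m i i' → row i' ≡ σ (σ (row i))
  row-two-steps {i} {i'} s = begin
    row i'                     ≡⟨ two-steps-label ρ ρ-wrap ρ-wrap₁ s ⟩
    ρ (suc (suc (toℕ i)))      ≡⟨ ρ-suc (suc (toℕ i)) ⟩
    σ (ρ (suc (toℕ i)))        ≡⟨ cong σ (ρ-suc (toℕ i)) ⟩
    σ (σ (row i))              ∎
    where
    ρ-wrap₁ : ρ (suc m) ≡ ρ 1
    ρ-wrap₁ = trans (ρ-suc m) (trans (cong σ ρ-wrap) (sym (ρ-suc 0)))

  column-step : ∀ {j j'} → CycleStep n j j' → column j' ≡ N (suc (toℕ j))
  column-step = step-label N N-wrap₀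

  column-two-steps : ∀ {j j'} → TwoSteps n j j' → column j' ≡ N (suc (suc (toℕ j)))
  column-two-steps = two-steps-label N N-wrap₀ N-wrap₁

  near-distinct : ∀ {u v} → Near u v → ¬ (colour u ≡ colour v)
  near-distinct {i , j} (vert₁ s) e =
    LocallyProper.vertical₁ (local j) (row i) (trans e (cong (column j) (row-step s)))
  near-distinct {i , j} (vert₂ s) e =
    LocallyProper.vertical₂ (local j) (row i) (trans e (cong (column j) (row-two-steps s)))
  near-distinct {i , j} (horiz₁ s) e =
    LocallyProper.horizontal₁ (local j) (row i) (trans e (cong-app (column-step s) (row i)))
  near-distinct {i , j} (horiz₂ s) e =
    LocallyProper.horizontal₂ (local j) (row i) (trans e (cong-app (column-two-steps s) (row i)))
  near-distinct {i , j} (diag↗ a b) e =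
    LocallyProper.diagonal↗ (local j) (row i)
      (trans e (cong₂ (λ f x → f x) (column-step b) (row-step a)))
  near-distinct {i , j} {i' , j'} (diag↘ a b) e =
    LocallyProper.diagonal↘ (local j') (row i) (begin
      column j' (σ (row i))   ≡⟨ cong (column j') (sym (row-step a)) ⟩
      column j' (row i')      ≡⟨ sym e ⟩
      column j (row i)        ≡⟨ cong-app (column-step b) (row i) ⟩
      N (suc (toℕ j')) (row i) ∎)

  colouring : χ≤ (square (T m n)) q
  colouring = colour , λ u v adj →
    [ near-distinct , (λ near e → near-distinct near (sym e)) ] (square-torus-neighbours adj)

-- Cyclic words

module _ {X : Set} where

  Windowed : (X → X → X → Set) → List X → Set
  Windowed P [] = ⊤
  Windowed P (x ∷ []) = ⊤
  Windowed P (x ∷ y ∷ []) = ⊤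
  Windowed P (x ∷ rest@(y ∷ z ∷ _)) = P x y z × Windowed P rest

  windowed? : ∀ {P : X → X → X → Set} → (∀ x y z → Dec (P x y z)) → ∀ xs → Dec (Windowed P xs)
  windowed? P? [] = yes tt
  windowed? P? (x ∷ []) = yes tt
  windowed? P? (x ∷ y ∷ []) = yes tt
  windowed? P? (x ∷ rest@(y ∷ z ∷ _)) = P? x y z ×-dec windowed? P? rest

  windowed-++ : ∀ {P A B} (b : List X) {r : List X} →
    Windowed P (b ++ A ∷ B ∷ []) → Windowed P (A ∷ B ∷ r) → Windowed P (b ++ A ∷ B ∷ r)
  windowed-++ [] _ w₂ = w₂
  windowed-++ (x ∷ []) (p , _) w₂ = p , w₂
  windowed-++ (x ∷ rest@(y ∷ [])) (p , w₁) w₂ = p , windowed-++ rest w₁ w₂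
  windowed-++ (x ∷ rest@(y ∷ z ∷ _)) (p , w₁) w₂ = p , windowed-++ rest w₁ w₂

  -- The cyclic word A B u is admissible: all its cyclic windows satisfy P.
  Closes : (X → X → X → Set) → X → X → List X → Set
  Closes P A B u = Windowed P ((A ∷ B ∷ u) ++ A ∷ B ∷ [])

  closes-++ : ∀ {P A B} (u v : List X) →
    Closes P A B u → Closes P A B v → Closes P A B (u ++ A ∷ B ∷ v)
  closes-++ {P} {A} {B} u v cu cv =
    subst (λ w → Windowed P (A ∷ B ∷ w)) (sym (++-assoc u (A ∷ B ∷ v) (A ∷ B ∷ [])))
      (windowed-++ (A ∷ B ∷ u) cu cv)

  pump : X → X → (u v : List X) → ℕ → List X
  pump A B u v zero = v
  pump A B u v (suc m) = u ++ A ∷ B ∷ pump A B u v m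

  closes-pump : ∀ {P A B} {u v : List X} →
    Closes P A B u → Closes P A B v → ∀ m → Closes P A B (pump A B u v m)
  closes-pump cu cv zero = cv
  closes-pump {u = u} cu cv (suc m) = closes-++ u _ cu (closes-pump cu cv m)

  length-pump : ∀ A B (u v : List X) m →
    length (A ∷ B ∷ pump A B u v m) ≡ m * length (A ∷ B ∷ u) + length (A ∷ B ∷ v)
  length-pump A B u v zero = refl
  length-pump A B u v (suc m) = begin
    suc (suc (length (u ++ A ∷ B ∷ pump A B u v m)))  ≡⟨ cong (suc ∘ suc) (length-++ u) ⟩
    ℓ + length (A ∷ B ∷ pump A B u v m)               ≡⟨ cong (ℓ +_) (length-pump A B u v m) ⟩
    ℓ + (m * ℓ + length (A ∷ B ∷ v))                  ≡⟨ sym (+-assoc ℓ (m * ℓ) _) ⟩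
    suc m * ℓ + length (A ∷ B ∷ v)                    ∎
    where
    ℓ : ℕ
    ℓ = length (A ∷ B ∷ u)

  index : X → List X → ℕ → X
  index d [] t = d
  index d (x ∷ xs) zero = x
  index d (x ∷ xs) (suc t) = index d xs t

  index-length : ∀ d (xs : List X) y ys → index d (xs ++ y ∷ ys) (length xs) ≡ y
  index-length d [] y ys = refl
  index-length d (x ∷ xs) y ys = index-length d xs y ys

  index-suc-length : ∀ d (xs : List X) y z ys → index d (xs ++ y ∷ z ∷ ys) (suc (length xs)) ≡ z
  index-suc-length d [] y z ys = refl
  index-suc-length d (x ∷ xs) y z ys = index-suc-length d xs y z ys

  window-at : ∀ {P} d (xs : List X) t → Windowed P xs → suc (suc t) < length xs →
    P (index d xs t) (index d xs (suc t)) (index d xs (suc (suc t)))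
  window-at d (x ∷ y ∷ z ∷ xs) zero (p , _) _ = p
  window-at d (x ∷ rest@(y ∷ z ∷ _)) (suc t) (_ , w) (s≤s lt) = window-at d rest t w lt
  window-at d (x ∷ []) t _ (s≤s ())
  window-at d (x ∷ y ∷ []) t _ (s≤s (s≤s ()))

  unroll : X → X → List X → ℕ → X
  unroll A B u = index A ((A ∷ B ∷ u) ++ A ∷ B ∷ [])

  unroll-wrap₀ : ∀ A B u → unroll A B u (length (A ∷ B ∷ u)) ≡ A
  unroll-wrap₀ A B u = index-length A (A ∷ B ∷ u) A (B ∷ [])

  unroll-wrap₁ : ∀ A B u → unroll A B u (suc (length (A ∷ B ∷ u))) ≡ B
  unroll-wrap₁ A B u = index-suc-length A (A ∷ B ∷ u) A B []

  unroll-local : ∀ {P A B} u → Closes P A B u → ∀ t → t < length (A ∷ B ∷ u) →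
    P (unroll A B u t) (unroll A B u (suc t)) (unroll A B u (suc (suc t)))
  unroll-local {A = A} {B} u closed t t<n = window-at A w t closed
    (subst (suc (suc t) <_) (trans (+-comm 2 (length (A ∷ B ∷ u))) (sym (length-++ (A ∷ B ∷ u))))
      (s≤s (s≤s t<n)))
    where
    w : List X
    w = (A ∷ B ∷ u) ++ A ∷ B ∷ []

σ₅ : Fin 5 → Fin 5
σ₅ fzero = # 1
σ₅ (fsuc fzero) = # 2
σ₅ (fsuc (fsuc fzero)) = # 3
σ₅ (fsuc (fsuc (fsuc fzero))) = # 4
σ₅ (fsuc (fsuc (fsuc (fsuc fzero)))) = # 0

σ₅-order : ∀ r → σ₅ (σ₅ (σ₅ (σ₅ (σ₅ r)))) ≡ r
σ₅-order fzero = refl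
σ₅-order (fsuc fzero) = refl
σ₅-order (fsuc (fsuc fzero)) = refl
σ₅-order (fsuc (fsuc (fsuc fzero))) = refl
σ₅-order (fsuc (fsuc (fsuc (fsuc fzero)))) = refl

ρ₅ : ℕ → Fin 5
ρ₅ zero = fzero
ρ₅ (suc t) = σ₅ (ρ₅ t)

ρ₅-period : ∀ k → ρ₅ (5 * k) ≡ ρ₅ 0
ρ₅-period k = trans (cong ρ₅ (*-comm 5 k)) (multiples k)
  where
  multiples : ∀ k → ρ₅ (k * 5) ≡ ρ₅ 0
  multiples zero = refl
  multiples (suc k) = trans (σ₅-order (ρ₅ (k * 5))) (multiples k)

Column : ℕ → Set
Column q = Fin 5 → Fin q

column : ∀ {q} → Fin q → Fin q → Fin q → Fin q → Fin q → Column q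
column a b c d e = lookup (a ∷ᵛ b ∷ᵛ c ∷ᵛ d ∷ᵛ e ∷ᵛ []ᵛ)

Admissible : ∀ {q} → Column q → Column q → List (Column q) → Set
Admissible = Closes (LocallyProper σ₅)

admissible? : ∀ {q} (A B : Column q) u → Dec (Admissible A B u)
admissible? A B u = windowed? (locallyProper? σ₅) ((A ∷ B ∷ u) ++ A ∷ B ∷ [])

word-colouring : ∀ {q} {A B : Column q} (u : List (Column q)) → Admissible A B u →
  ∀ k → χ≤ (square (T (5 * k) (length (A ∷ B ∷ u)))) q
word-colouring {A = A} {B} u admissible k =
  PatternColouring.colouring σ₅ ρ₅ (λ _ → refl) (unroll A B u)
    (ρ₅-period k) (unroll-wrap₀ A B u) (unroll-wrap₁ A B u) (unroll-local u admissible)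

pumped-colouring : ∀ {q} {A B : Column q} (u v : List (Column q)) →
  Admissible A B u → Admissible A B v →
  ∀ k m → χ≤ (square (T (5 * k) (m * length (A ∷ B ∷ u) + length (A ∷ B ∷ v)))) q
pumped-colouring {q = q} {A} {B} u v au av k m =
  subst (λ n → χ≤ (square (T (5 * k) n)) q) (length-pump A B u v m)
    (word-colouring (pump A B u v m) (closes-pump au av m) k)

-- Explicit words

-- n ≡ 0 (mod 5): the 5-colouring (i , j) ↦ i + 2j mod 5, as a word pumped by itself.
module FiveColours where
  A B : Column 5
  A = column (# 0) (# 1) (# 2) (# 3) (# 4)
  B = column (# 2) (# 3) (# 4) (# 0) (# 1)

  block : List (Column 5)
  block = column (# 4) (# 0) (# 1) (# 2) (# 3) ∷ column (# 1) (# 2) (# 3) (# 4) (# 0)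
        ∷ column (# 3) (# 4) (# 0) (# 1) (# 2) ∷ []

  colouring : ∀ k m → χ≤ (square (T (5 * k) (m * 5 + 5))) 5
  colouring = pumped-colouring block block admissible admissible
    where
    admissible : Admissible A B block
    admissible = from-yes (admissible? A B block)

module SixColours where
  A B : Column 6
  A = column (# 0) (# 1) (# 2) (# 3) (# 4)
  B = column (# 2) (# 3) (# 0) (# 5) (# 1)

  block₅ block₆ block₈ block₉ block₁₂ : List (Column 6)
  block₅ = column (# 4) (# 5) (# 1) (# 2) (# 0) ∷ column (# 1) (# 0) (# 3) (# 4) (# 5)
         ∷ column (# 3) (# 4) (# 5) (# 0) (# 2) ∷ []
  block₆ = column (# 5) (# 4) (# 1) (# 2) (# 0) ∷ column (# 1) (# 0) (# 5) (# 4) (# 3)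
         ∷ column (# 4) (# 2) (# 3) (# 0) (# 5) ∷ column (# 3) (# 5) (# 4) (# 1) (# 2) ∷ []
  block₈ = column (# 4) (# 5) (# 1) (# 2) (# 0) ∷ column (# 1) (# 0) (# 4) (# 3) (# 5)
         ∷ column (# 2) (# 3) (# 5) (# 0) (# 4) ∷ column (# 5) (# 4) (# 1) (# 2) (# 3)
         ∷ column (# 1) (# 2) (# 3) (# 5) (# 0) ∷ column (# 3) (# 5) (# 4) (# 1) (# 2) ∷ []
  block₉ = column (# 4) (# 5) (# 1) (# 2) (# 3) ∷ column (# 0) (# 2) (# 3) (# 4) (# 5)
         ∷ column (# 3) (# 1) (# 5) (# 0) (# 2) ∷ column (# 5) (# 0) (# 4) (# 3) (# 1)
         ∷ column (# 4) (# 3) (# 1) (# 2) (# 0) ∷ column (# 1) (# 2) (# 0) (# 4) (# 5)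
         ∷ column (# 3) (# 4) (# 5) (# 1) (# 2) ∷ []
  block₁₂ = block₆ ++ A ∷ B ∷ block₆

  admissible₅ : Admissible A B block₅
  admissible₅ = from-yes (admissible? A B block₅)

  admissible₆ : Admissible A B block₆
  admissible₆ = from-yes (admissible? A B block₆)

  admissible₁₂ : Admissible A B block₁₂
  admissible₁₂ = closes-++ {P = LocallyProper σ₅} {A} {B} block₆ block₆ admissible₆ admissible₆

  colouring₆ : ∀ k m → χ≤ (square (T (5 * k) (m * 5 + 6))) 6
  colouring₆ = pumped-colouring block₅ block₆ admissible₅ admissible₆

  colouring₈ : ∀ k m → χ≤ (square (T (5 * k) (m * 5 + 8))) 6
  colouring₈ = pumped-colouring block₅ block₈ admissible₅ (from-yes (admissible? A B block₈))

  colouring₉ : ∀ k m → χ≤ (square (T (5 * k) (m * 5 + 9))) 6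
  colouring₉ = pumped-colouring block₅ block₉ admissible₅ (from-yes (admissible? A B block₉))

  colouring₁₂ : ∀ k m → χ≤ (square (T (5 * k) (m * 5 + 12))) 6
  colouring₁₂ = pumped-colouring block₅ block₁₂ admissible₅ admissible₁₂

module SevenColours where
  A B : Column 7
  A = column (# 0) (# 1) (# 2) (# 3) (# 4)
  B = column (# 2) (# 3) (# 0) (# 1) (# 5)

  word : List (Column 7)
  word = column (# 1) (# 4) (# 5) (# 2) (# 6) ∷ column (# 0) (# 2) (# 6) (# 3) (# 4)
       ∷ column (# 6) (# 5) (# 4) (# 1) (# 2) ∷ column (# 4) (# 0) (# 3) (# 6) (# 5)
       ∷ column (# 3) (# 6) (# 5) (# 0) (# 1) ∷ []

  colouring : ∀ k → χ≤ (square (T (5 * k) 7)) 7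
  colouring = word-colouring word (from-yes (admissible? A B word))

data Realised : ℕ → Set where
  residue₀ : ∀ m → Realised (m * 5 + 5)
  residue₁ : ∀ m → Realised (m * 5 + 6)
  seven    : Realised 7
  residue₂ : ∀ m → Realised (m * 5 + 12)
  residue₃ : ∀ m → Realised (m * 5 + 8)
  residue₄ : ∀ m → Realised (m * 5 + 9)

realised : ∀ d → Realised (5 + d)
realised 0 = residue₀ 0
realised 1 = residue₁ 0
realised 2 = seven
realised 3 = residue₃ 0
realised 4 = residue₄ 0
realised (suc (suc (suc (suc (suc d))))) = five-more (realised d)
  where
  five-more : ∀ {n} → Realised n → Realised (5 + n)
  five-more (residue₀ m) = residue₀ (suc m)
  five-more (residue₁ m) = residue₁ (suc m)
  five-more seven = residue₂ 0
  five-more (residue₂ m) = residue₂ (suc m)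
  five-more (residue₃ m) = residue₃ (suc m)
  five-more (residue₄ m) = residue₄ (suc m)

residue : ∀ m r → (m * 5 + r) % 5 ≡ r % 5
residue m r = trans (cong (_% 5) (+-comm (m * 5) r)) ([m+kn]%n≡m%n r m 5)

five-colours : ∀ k {n} → Realised n → n % 5 ≡ 0 → χ≤ (square (T (5 * k) n)) 5
five-colours k (residue₀ m) _ = FiveColours.colouring k m
five-colours k (residue₁ m) n≡0 with () ← trans (sym (residue m 6)) n≡0
five-colours k seven ()
five-colours k (residue₂ m) n≡0 with () ← trans (sym (residue m 12)) n≡0
five-colours k (residue₃ m) n≡0 with () ← trans (sym (residue m 8)) n≡0
five-colours k (residue₄ m) n≡0 with () ← trans (sym (residue m 9)) n≡0

six-colours : ∀ k {n} → Realised n → ¬ (n % 5 ≡ 0) → ¬ (n ≡ 7) → χ≤ (square (T (5 * k) n)) 6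
six-colours k (residue₀ m) n≢0 _ = ⊥-elim (n≢0 (residue m 5))
six-colours k (residue₁ m) _ _ = SixColours.colouring₆ k m
six-colours k seven _ n≢7 = ⊥-elim (n≢7 refl)
six-colours k (residue₂ m) _ _ = SixColours.colouring₁₂ k m
six-colours k (residue₃ m) _ _ = SixColours.colouring₈ k m
six-colours k (residue₄ m) _ _ = SixColours.colouring₉ k m

corollary4 : (k n : ℕ) → 1 ≤ k → 5 ≤ n →
    (n % 5 ≡ 0 → χ≤ (square (T (5 * k) n)) 5) ×
    (n ≡ 7 → χ≤ (square (T (5 * k) n)) 7) ×
    (¬ (n % 5 ≡ 0) → ¬ (n ≡ 7) → χ≤ (square (T (5 * k) n)) 6)
corollary4 k n _ 5≤n with d , refl ← m≤n⇒∃[o]m+o≡n 5≤n =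
  five-colours k (realised d) , (λ { refl → SevenColours.colouring k }) , six-colours k (realised d)
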